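{- Let $G=(V,E)$ be a directed, connected, acyclic graph without parallel arcs, let $\mathcal{C}=\{1,\dots,K\}$ be ordered by $1\prec 2\prec\cdots\prec K$, let $f\colon E\to\mathcal{C}$, let $s,t\in V$, and let $\mathcal{P}$ be the set of directed $s$-$t$-paths. Then the ordinal dominance relation $\precsim$ on $\mathcal{P}$ (defined in the context) is a preorder, i.e., it is reflexive and transitive.
   Context: The levels are compared by the total order $\preceq$ on $\mathcal{C}$ ($x\preceq y$ iff $x\prec y$ or $x=y$; smaller levels are better). For a path $P=(s,e_1,v_1,\dots,v_{k-1},e_k,t)$, its ordinal path vector is $f(P)=(f(e_1),\dots,f(e_k))$ and $\mathrm{len}(f(P))=k$. $\mathrm{sort}(f(P))$ is the vector $f(P)$ rearranged in non-decreasing order (w.r.t. $\preceq$); for $j\le k$, $\mathrm{sort}^{forw}_j(f(P))$ is the vector of the first $j$ entries of $\mathrm{sort}(f(P))$ and $\mathrm{sort}^{backw}_j(f(P))$ the vector of the last $j$ entries. For $x,y\in\mathcal{C}^r$ write $x\leqq y$ iff $x^i\preceq y^i$ for all $i=1,\dots,r$. For $P_1,P_2\in\mathcal{P}$ with $a=\mathrm{len}(f(P_1))$ and $b=\mathrm{len}(f(P_2))$, define $P_1\precsim P_2$ iff: $\mathrm{sort}(f(P_1))\leqq \mathrm{sort}(f(P_2))$ when $a=b$; $\mathrm{sort}^{backw}_b(f(P_1))\leqq \mathrm{sort}(f(P_2))$ when $a>b$; $\mathrm{sort}(f(P_1))\leqq \mathrm{sort}^{forw}_a(f(P_2))$ when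 $a<b$. -}

module Defs where

open import Data.Nat using (ℕ; zero; suc; _∸_; _<_; _>_)
open import Data.Nat.Properties using (<-cmp)
open import Data.Fin using (Fin)
import Data.Fin
import Data.Fin.Properties as FinP
open import Data.Bool using (Bool; T)
open import Data.List using (List; []; _∷_; length; take; drop; map)
open import Data.List.Relation.Unary.Unique.Propositional using (Unique)
open import Data.List.Relation.Binary.Pointwise using (Pointwise)
open import Data.Product using (Σ; proj₁)
open import Data.Sum using (_⊎_)
open import Relation.Binary.PropositionalEquality using (_≡_)
open import Relation.Binary.Definitions using (Tri; tri<; tri≈; tri>)
open import Relation.Nullary using (¬_)

-- Representing arcs by
-- a Boolean matrix means there are no parallel arcs by construction.
Digraph : ℕ → Set
Digraph n = Fin n → Fin n → Bool

module _ {n : ℕ} (G : Digraph n) where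

  Arc : Fin n → Fin n → Set
  Arc u v = T (G u v)

  data Walk : Fin n → Fin n → Set where
    []  : ∀ {v} → Walk v v
    _∷_ : ∀ {u v w} → Arc u v → Walk v w → Walk u w

  walkLength : ∀ {u w} → Walk u w → ℕ
  walkLength [] = zero
  walkLength (_ ∷ p) = suc (walkLength p)

  vertices : ∀ {u w} → Walk u w → List (Fin n)
  vertices {u} [] = u ∷ []
  vertices {u} (_ ∷ p) = u ∷ vertices p

  Path : Fin n → Fin n → Set
  Path s t = Σ (Walk s t) (λ p → Unique (vertices p))

  Acyclic : Set
  Acyclic = ∀ v (p : Walk v v) → walkLength p ≡ zero

  data UWalk : Fin n → Fin n → Set where
    []   : ∀ {v} → UWalk v v
    fwd  : ∀ {u v w} → Arc u v → UWalk v w → UWalk u w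
    bwd  : ∀ {u v w} → Arc v u → UWalk v w → UWalk u w

  -- connected (for a digraph: weakly connected)
  Connected : Set
  Connected = ∀ u v → UWalk u v

  -- levels C = {1,...,K} are represented by Fin K, with 1 ≺ ... ≺ K
  -- corresponding to the usual order on Fin K (index i ↔ level i+1).
  module Levels {K : ℕ} (f : ∀ u v → Arc u v → Fin K) where

    ordVec : ∀ {u w} → Walk u w → List (Fin K)
    ordVec [] = []
    ordVec {u} (_∷_ {v = v} a p) = f u v a ∷ ordVec p

    sortC : List (Fin K) → List (Fin K)
    sortC = sort
      where open import Data.List.Sort (FinP.≤-decTotalOrder K) using (sort)

    _≦_ : List (Fin K) → List (Fin K) → Set
    _≦_ = Pointwise Data.Fin._≤_

    sortForw : ℕ → List (Fin K) → List (Fin K)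
    sortForw j x = take j (sortC x)

    sortBackw : ℕ → List (Fin K) → List (Fin K)
    sortBackw j x = drop (length x ∸ j) (sortC x)

    dom : List (Fin K) → List (Fin K) → Set
    dom x y = go (<-cmp (length x) (length y))
      where
      go : ∀ {A B C : Set} → Tri A B C → Set
      go (tri< _ _ _) = sortC x ≦ sortForw (length x) y
      go (tri≈ _ _ _) = sortC x ≦ sortC y
      go (tri> _ _ _) = sortBackw (length y) x ≦ sortC y

    _≾_ : ∀ {s t} → Path s t → Path s t → Set
    P₁ ≾ P₂ = dom (ordVec (proj₁ P₁)) (ordVec (proj₁ P₂))

module Submission where

-- Let X, Y be the sorted ordinal path vectors of two paths, of lengths a, b.
-- In each of the three cases of its definition, P₁ ≾ P₂ says the same thing:
-- the largest min(a,b) entries of X are dominated entrywise by the smallest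
-- min(a,b) entries of Y, i.e.  X[(a ∸ b) + i] ≤ Y[i]  for all admissible i.  In list form (Dom, via drop and take) it is reflexive; in index
-- form (ShiftDom) it is transitive as soon as the middle list is nonempty
-- whenever the first one is, by a zigzag through the three sorted lists
--   X[j] ≤ X[d + k] ≤ Y[k] ≤ Y[e + l] ≤ Z[l] ≤ Z[i]
-- for well chosen indices k, l.  For paths, the case-wise relation dom on
-- ordinal vectors is Dom on their sorted versions, and the side condition
-- holds by acyclicity: if some s-t path is empty then s = t, so every s-t
-- walk is a closed walk and therefore empty as well.

open import Defs
open import Data.Nat using (ℕ)
open import Data.Fin using (Fin)
open import Data.Product using (_×_)
open import Relation.Binary.Definitions using (Reflexive; Transitive)

open import Data.Nat using (zero; suc; pred; _+_; _⊓_; _∸_; _<_; _≤_; z≤n; s≤s; s≤s⁻¹; _<?_)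
open import Data.Nat.Properties
  using ( <-irrelevant; ≤-total; <-cmp; ≤-refl; ≤-reflexive; ≤-trans; ≤-<-trans; <⇒≤; ≮⇒≥
        ; m≤n+m; m≤n+m∸n; +-comm; +-assoc; +-monoʳ-≤; +-monoˡ-≤; +-monoʳ-<
        ; m≤n⇒m∸n≡0; m+[n∸m]≡n; m≤n+o⇒m∸n≤o; n∸n≡0; ⊓-pres-m<; m≤n⇒m⊓n≡m; m≥n⇒m⊓n≡n
        ; m∸[m∸n]≡n; module ≤-Reasoning )
import Data.Fin.Properties as FinP
open import Data.List using (List; []; _∷_; length; take; drop)
open import Data.List.Properties using (length-take; length-drop; take-all)
open import Data.List.Relation.Binary.Pointwise using (Pointwise; []; _∷_)
open import Data.List.Relation.Binary.Pointwise.Properties using (Pointwise-length)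
import Data.List.Relation.Binary.Pointwise.Properties as Pointwise
open import Data.List.Relation.Unary.Linked using (Linked; []; _∷_; tail)
open import Data.List.Relation.Binary.Permutation.Propositional.Properties using (↭-length)
open import Data.Product using (Σ; _,_; proj₁; proj₂)
open import Data.Sum using (inj₁; inj₂)
open import Relation.Binary.Bundles using (Preorder)
open import Relation.Binary.PropositionalEquality
  using (_≡_; refl; sym; trans; cong; subst; subst₂)
open import Relation.Binary.Definitions using (tri<; tri≈; tri>)
open import Relation.Nullary using (yes; no)
open import Function using (id)

module ListIndex {a} {A : Set a} where

  nth : (X : List A) (i : ℕ) → i < length X → A
  nth (x ∷ X) zero    _         = x
  nth (x ∷ X) (suc i) (s≤s i<n) = nth X i i<n

  nth-irrelevant : ∀ X {i} (p q : i < length X) → nth X i p ≡ nth X i q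
  nth-irrelevant X p q rewrite <-irrelevant p q = refl

  nth-take : ∀ m X i (p : i < length (take m X)) →
             Σ (i < length X) λ q → nth (take m X) i p ≡ nth X i q
  nth-take zero    X       i       ()
  nth-take (suc m) []      i       ()
  nth-take (suc m) (x ∷ X) zero    _       = s≤s z≤n , refl
  nth-take (suc m) (x ∷ X) (suc i) (s≤s p) with nth-take m X i p
  ... | q , eq = s≤s q , eq

  nth-drop : ∀ d X i (p : i < length (drop d X)) →
             Σ (d + i < length X) λ q → nth (drop d X) i p ≡ nth X (d + i) q
  nth-drop zero    X       i p = p , refl
  nth-drop (suc d) []      i ()
  nth-drop (suc d) (x ∷ X) i p with nth-drop d X i p
  ... | q , eq = s≤s q , eq

  module _ {r} {R : A → A → Set r} where

    Pointwise⇒nth : ∀ {X Y} → Pointwise R X Y →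
                    ∀ i (p : i < length X) (q : i < length Y) → R (nth X i p) (nth Y i q)
    Pointwise⇒nth (r ∷ _)  zero    _       _       = r
    Pointwise⇒nth (_ ∷ rs) (suc i) (s≤s p) (s≤s q) = Pointwise⇒nth rs i p q

    nth⇒Pointwise : ∀ X Y → length X ≡ length Y →
                    (∀ i (p : i < length X) (q : i < length Y) → R (nth X i p) (nth Y i q)) →
                    Pointwise R X Y
    nth⇒Pointwise []      []      _  _ = []
    nth⇒Pointwise (x ∷ X) (y ∷ Y) eq h =
      h zero (s≤s z≤n) (s≤s z≤n) ∷
      nth⇒Pointwise X Y (cong pred eq) (λ i p q → h (suc i) (s≤s p) (s≤s q))

    nth-mono : (∀ {x} → R x x) → (∀ {x y z} → R x y → R y z → R x z) →
               ∀ {X} → Linked R X → ∀ {i j} (p : i < length X) (q : j < length X) →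
               i ≤ j → R (nth X i p) (nth X j q)
    nth-mono R-refl R-trans {x ∷ X} _ {zero} {zero} _ _ _ = R-refl
    nth-mono R-refl R-trans {x ∷ X} (r ∷ sorted) {zero} {suc j} _ (s≤s q) _ =
      R-trans r (nth-mono R-refl R-trans sorted (s≤s z≤n) q z≤n)
    nth-mono R-refl R-trans {x ∷ X} sorted {suc i} {suc j} (s≤s p) (s≤s q) (s≤s i≤j) =
      nth-mono R-refl R-trans (tail sorted) p q i≤j

open ListIndex

module ShiftArithmetic where

  shift-bound : ∀ {l a b} → l < a → l < b → (a ∸ b) + l < a
  shift-bound {l} {a} {b} l<a l<b with ≤-total a b
  ... | inj₁ a≤b rewrite m≤n⇒m∸n≡0 a≤b = l<a
  ... | inj₂ b≤a = subst ((a ∸ b) + l <_) (trans (+-comm (a ∸ b) b) (m+[n∸m]≡n b≤a))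
                         (+-monoʳ-< (a ∸ b) l<b)

  ∸-triangle : ∀ a b c → a ∸ c ≤ (a ∸ b) + (b ∸ c)
  ∸-triangle a b c = m≤n+o⇒m∸n≤o a c (begin
    a                            ≤⟨ m≤n+m∸n a b ⟩
    b + (a ∸ b)                  ≤⟨ +-monoˡ-≤ (a ∸ b) (m≤n+m∸n b c) ⟩
    (c + (b ∸ c)) + (a ∸ b)      ≡⟨ +-assoc c (b ∸ c) (a ∸ b) ⟩
    c + ((b ∸ c) + (a ∸ b))      ≡⟨ cong (c +_) (+-comm (b ∸ c) (a ∸ b)) ⟩
    c + ((a ∸ b) + (b ∸ c))      ∎)
    where open ≤-Reasoning

  m∸[m∸n]≡m⊓n : ∀ m n → m ∸ (m ∸ n) ≡ m ⊓ n
  m∸[m∸n]≡m⊓n m n with ≤-total m n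
  ... | inj₁ m≤n rewrite m≤n⇒m∸n≡0 m≤n = sym (m≤n⇒m⊓n≡m m≤n)
  ... | inj₂ n≤m = trans (m∸[m∸n]≡n n≤m) (sym (m≥n⇒m⊓n≡n n≤m))

open ShiftArithmetic

module ShiftedDomination {c ℓ₁ ℓ₂} (P : Preorder c ℓ₁ ℓ₂) where
  open Preorder P using (_≲_) renaming (Carrier to A; refl to ≲-refl; trans to ≲-trans)

  Sorted : List A → Set _
  Sorted = Linked _≲_

  Dom : List A → List A → Set _
  Dom X Y = Pointwise _≲_ (drop (length X ∸ length Y) X) (take (length X) Y)

  ShiftDom : ℕ → List A → List A → Set _
  ShiftDom d X Y = ∀ i (p : d + i < length X) (q : i < length Y) → nth X (d + i) p ≲ nth Y i q

  Dom-refl : ∀ X → Dom X X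
  Dom-refl X rewrite n∸n≡0 (length X) | take-all (length X) X ≤-refl = Pointwise.refl ≲-refl

  Dom⇒ShiftDom : ∀ {X Y} → Dom X Y → ShiftDom (length X ∸ length Y) X Y
  Dom⇒ShiftDom {X} {Y} H i p q =
    subst₂ _≲_ (trans (proj₂ X-entry) (nth-irrelevant X (proj₁ X-entry) p))
               (trans (proj₂ Y-entry) (nth-irrelevant Y (proj₁ Y-entry) q))
               (Pointwise⇒nth H i i<drop i<take)
    where
    d : ℕ
    d = length X ∸ length Y
    i<take : i < length (take (length X) Y)
    i<take = subst (i <_) (sym (length-take (length X) Y))
                   (⊓-pres-m< (≤-<-trans (m≤n+m i d) p) q)
    i<drop : i < length (drop d X)
    i<drop = subst (i <_) (sym (Pointwise-length H)) i<take
    X-entry : Σ (d + i < length X) λ p′ → nth (drop d X) i i<drop ≡ nth X (d + i) p′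
    X-entry = nth-drop d X i i<drop
    Y-entry : Σ (i < length Y) λ q′ → nth (take (length X) Y) i i<take ≡ nth Y i q′
    Y-entry = nth-take (length X) Y i i<take

  ShiftDom⇒Dom : ∀ {X Y} → ShiftDom (length X ∸ length Y) X Y → Dom X Y
  ShiftDom⇒Dom {X} {Y} S = nth⇒Pointwise (drop d X) (take (length X) Y) same-length entries
    where
    d : ℕ
    d = length X ∸ length Y
    same-length : length (drop d X) ≡ length (take (length X) Y)
    same-length = trans (length-drop d X)
                        (trans (m∸[m∸n]≡m⊓n (length X) (length Y)) (sym (length-take (length X) Y)))
    entries : ∀ i (p : i < length (drop d X)) (q : i < length (take (length X) Y)) →
              nth (drop d X) i p ≲ nth (take (length X) Y) i q
    entries i p q with nth-drop d X i p | nth-take (length X) Y i q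
    ... | p′ , eqX | q′ , eqY = subst₂ _≲_ (sym eqX) (sym eqY) (S i p′ q′)

  -- Transitivity.  The side condition excludes an empty middle list between
  -- nonempty ones, for which both hypotheses would be vacuous.
  ShiftDom-trans : ∀ {X Y Z} → Sorted X → Sorted Y → Sorted Z →
                   (length Y ≡ 0 → length X ≡ 0) →
                   ShiftDom (length X ∸ length Y) X Y → ShiftDom (length Y ∸ length Z) Y Z →
                   ShiftDom (length X ∸ length Z) X Z
  ShiftDom-trans {[]}    _ _ _ _ _ _ _ () _
  ShiftDom-trans {_ ∷ _} {[]} _ _ _ Y-empty⇒X-empty _ _ _ _ _ with Y-empty⇒X-empty refl
  ... | ()
  ShiftDom-trans {X@(_ ∷ X′)} {Y@(_ ∷ Y′)} {Z} sX sY sZ _ S₁ S₂ i p q = choose-l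
    where
    d e j : ℕ
    d = length X ∸ length Y
    e = length Y ∸ length Z
    j = (length X ∸ length Z) + i

    j≤last : j ≤ length X′
    j≤last = s≤s⁻¹ p

    zigzag : ∀ k l → j ≤ d + k → k ≤ e + l → l ≤ i → k < length X → l < length Y →
             nth X j p ≲ nth Z i q
    zigzag k l j≤d+k k≤e+l l≤i k<a l<b = begin
      nth X j p          ≲⟨ nth-mono ≲-refl ≲-trans sX p d+k<a j≤d+k ⟩
      nth X (d + k) d+k<a ≲⟨ S₁ k d+k<a k<b ⟩
      nth Y k k<b        ≲⟨ nth-mono ≲-refl ≲-trans sY k<b e+l<b k≤e+l ⟩
      nth Y (e + l) e+l<b ≲⟨ S₂ l e+l<b l<c ⟩
      nth Z l l<c        ≲⟨ nth-mono ≲-refl ≲-trans sZ l<c q l≤i ⟩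
      nth Z i q          ∎
      where
      open import Relation.Binary.Reasoning.Preorder P
      l<c : l < length Z
      l<c = ≤-<-trans l≤i q
      e+l<b : e + l < length Y
      e+l<b = shift-bound l<b l<c
      k<b : k < length Y
      k<b = ≤-<-trans k≤e+l e+l<b
      d+k<a : d + k < length X
      d+k<a = shift-bound k<a k<b

    -- given l, take k = e + l if that is in range for X, else the last index of X
    choose-k : ∀ l → l ≤ i → l < length Y → (e + l < length X → j ≤ d + (e + l)) →
               nth X j p ≲ nth Z i q
    choose-k l l≤i l<b j≤d+e+l with e + l <? length X
    ... | yes e+l<a = zigzag (e + l) l (j≤d+e+l e+l<a) ≤-refl l≤i e+l<a l<b
    ... | no  e+l≮a = zigzag (length X′) l (≤-trans j≤last (m≤n+m (length X′) d))
                             (<⇒≤ (≮⇒≥ e+l≮a)) l≤i ≤-refl l<b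

    -- take l = i if that is in range for Y, else the last index of Y
    choose-l : nth X j p ≲ nth Z i q
    choose-l with i <? length Y
    ... | yes i<b = choose-k i ≤-refl i<b (λ _ → j≤d+e+i)
      where
      j≤d+e+i : j ≤ d + (e + i)
      j≤d+e+i = subst (j ≤_) (+-assoc d e i)
                      (+-monoˡ-≤ i (∸-triangle (length X) (length Y) (length Z)))
    ... | no  i≮b = choose-k (length Y′) (<⇒≤ (≮⇒≥ i≮b)) ≤-refl (λ _ → j≤d+e+last)
      where
      j≤d+e+last : j ≤ d + (e + length Y′)
      j≤d+e+last = ≤-trans j≤last (≤-trans (subst (length X′ ≤_) (+-comm (length Y′) d)
                                                   (m≤n+m∸n (length X′) (length Y′)))
                                           (+-monoʳ-≤ d (m≤n+m (length Y′) e)))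

  Dom-trans : ∀ {X Y Z} → Sorted X → Sorted Y → Sorted Z →
              (length Y ≡ 0 → length X ≡ 0) → Dom X Y → Dom Y Z → Dom X Z
  Dom-trans sX sY sZ Y-empty⇒X-empty H₁ H₂ =
    ShiftDom⇒Dom (ShiftDom-trans sX sY sZ Y-empty⇒X-empty (Dom⇒ShiftDom H₁) (Dom⇒ShiftDom H₂))

module OrdinalDominance {n} (G : Digraph n) {K} (f : ∀ u v → Arc G u v → Fin K) where
  open Levels G f
  open ShiftedDomination (FinP.≤-preorder K)
  open import Data.List.Sort (FinP.≤-decTotalOrder K) using (sort-↭; sort-↗)

  length-sortC : ∀ x → length (sortC x) ≡ length x
  length-sortC x = ↭-length (sort-↭ x)

  sortC-sorted : ∀ x → Sorted (sortC x)
  sortC-sorted = sort-↗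

  dom≡Dom : ∀ x y → dom x y ≡ Dom (sortC x) (sortC y)
  dom≡Dom x y rewrite length-sortC x | length-sortC y with <-cmp (length x) (length y)
  ... | tri< a<b _ _ rewrite m≤n⇒m∸n≡0 (<⇒≤ a<b) = refl
  ... | tri≈ _ a≡b _ rewrite a≡b | n∸n≡0 (length y) =
    cong (Pointwise _ (sortC x)) (sym (take-all (length y) (sortC y) (≤-reflexive (length-sortC y))))
  ... | tri> _ _ b<a =
    cong (Pointwise _ (sortBackw (length y) x))
         (sym (take-all (length x) (sortC y) (≤-trans (≤-reflexive (length-sortC y)) (<⇒≤ b<a))))

  length-ordVec : ∀ {u w} (p : Walk G u w) → length (ordVec p) ≡ walkLength G p
  length-ordVec []      = refl
  length-ordVec (_ ∷ p) = cong suc (length-ordVec p)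

  -- in an acyclic graph, if one s-t walk is empty then s = t and every s-t walk,
  -- being closed, is empty too
  empty-walk⇒empty : Acyclic G → ∀ {s t} (w w′ : Walk G s t) →
                     walkLength G w′ ≡ 0 → walkLength G w ≡ 0
  empty-walk⇒empty acyclic w []      _  = acyclic _ w
  empty-walk⇒empty acyclic w (_ ∷ _) ()

  ≾-refl : ∀ {s t} → Reflexive (_≾_ {s} {t})
  ≾-refl {x = P} = subst id (sym (dom≡Dom x x)) (Dom-refl (sortC x))
    where
    x : List (Fin K)
    x = ordVec (proj₁ P)

  ≾-trans : Acyclic G → ∀ {s t} → Transitive (_≾_ {s} {t})
  ≾-trans acyclic {i = P} {j = Q} {k = R} P≾Q Q≾R =
    subst id (sym (dom≡Dom x z))
      (Dom-trans (sortC-sorted x) (sortC-sorted y) (sortC-sorted z) Y-empty⇒X-empty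
                 (subst id (dom≡Dom x y) P≾Q) (subst id (dom≡Dom y z) Q≾R))
    where
    x y z : List (Fin K)
    x = ordVec (proj₁ P)
    y = ordVec (proj₁ Q)
    z = ordVec (proj₁ R)
    Y-empty⇒X-empty : length (sortC y) ≡ 0 → length (sortC x) ≡ 0
    Y-empty⇒X-empty |Y|≡0 =
      trans (length-sortC x) (trans (length-ordVec (proj₁ P))
        (empty-walk⇒empty acyclic (proj₁ P) (proj₁ Q)
          (trans (sym (length-ordVec (proj₁ Q))) (trans (sym (length-sortC y)) |Y|≡0))))

-- Ordinal dominance is a preorder on the s-t-paths.
mainTheorem1 : (n K : ℕ) (G : Digraph n) → Connected G → Acyclic G
    → (f : ∀ u v → Arc G u v → Fin K) (s t : Fin n)
    → Reflexive (Levels._≾_ G f {s} {t}) × Transitive (Levels._≾_ G f {s} {t})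
mainTheorem1 n K G _ acyclic f s t =
  (λ {P} → ≾-refl {s} {t} {P}) , (λ {P Q R} → ≾-trans acyclic {s} {t} {P} {Q} {R})
  where open OrdinalDominance G f
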